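{- The length of every hexagonal Tangle is congruent to $3$ modulo $6$.
   Context: Fix $r>0$ and let $\mathscr T$ be the tiling of the plane by regular hexagons of side length $2r$. Center a circle of radius $r$ at each vertex of $\mathscr T$; circles at adjacent vertices are tangent at the midpoint of the common edge. A link is a third of one of these circles whose endpoints are two consecutive tangency points with circles at adjacent vertices. A hexagonal Tangle is a smooth (continuously turning tangent) simple closed curve that is the union of finitely many links. Its length is the number of links it consists of. -}

module Defs where

open import Data.Nat using (ℕ; suc; _<_)
open import Data.Nat.DivMod using (_mod_)
open import Data.Integer using (ℤ; _+_; +_)
open import Data.Fin using (Fin; zero; suc; toℕ)
open import Data.Bool using (Bool; true; false; not)
open import Data.Product using (_×_; _,_)
open import Relation.Binary.PropositionalEquality using (_≡_)

-- Vertices come in two classes A and B (the tiling graph is bipartite).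
-- Fix unit vectors d₀, d₁, d₂ at angles 90°, 210°, 330° (counterclockwise order).
-- The A-vertex with coordinates (a , b) sits at position a(d₀-d₁) + b(d₀-d₂)
-- (scaled by the side length 2r); its three edges leave it in directions d₀, d₁, d₂.
-- The B-vertex with coordinates (a , b) sits at (A-vertex (a , b)) + 2r d₀;
-- its three edges leave it in directions -d₀, -d₁, -d₂ (again counterclockwise order).
data Side : Set where
  A B : Side

Vertex : Set
Vertex = Side × ℤ × ℤ

-- An edge of 𝒯 (equivalently a tangency point = the midpoint of the edge) is
-- named by the coordinates of its A-endpoint and its direction index k
-- (the edge in direction d_k from that A-vertex).
Edge : Set
Edge = ℤ × ℤ × Fin 3

-- A(a,b) is joined to B(a,b), B(a-1,b), B(a,b-1) along d₀, d₁, d₂;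
-- B(a,b) is joined to A(a,b), A(a+1,b), A(a,b+1) along -d₀, -d₁, -d₂.
edgeAt : Vertex → Fin 3 → Edge
edgeAt (A , a , b) k = (a , b , k)
edgeAt (B , a , b) zero = (a , b , zero)
edgeAt (B , a , b) (suc zero) = (a + + 1 , b , suc zero)
edgeAt (B , a , b) (suc (suc zero)) = (a , b + + 1 , suc (suc zero))

-- cyclic successor on Fin 3 (next tangency point counterclockwise)
next3 : Fin 3 → Fin 3
next3 zero = suc zero
next3 (suc zero) = suc (suc zero)
next3 (suc (suc zero)) = zero

-- A link: (v , j) is the third of the circle of radius r centred at v that runs
-- counterclockwise from the tangency point on edge j of v to the tangency point on
-- edge (j+1 mod 3) of v.  Every link arises exactly once this way.
Link : Set
Link = Vertex × Fin 3

-- A traversed link: a link together with a direction of traversal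
-- (true = counterclockwise about its centre, i.e. from edge j to edge j+1;
--  false = clockwise, from edge j+1 to edge j).
Step : Set
Step = Link × Bool

link : Step → Link
link (l , _) = l

entry : Step → Edge
entry ((v , j) , true) = edgeAt v j
entry ((v , j) , false) = edgeAt v (next3 j)

exit : Step → Edge
exit ((v , j) , true) = edgeAt v (next3 j)
exit ((v , j) , false) = edgeAt v j

-- Direction of motion at a tangency point on edge k, expressed relative to the
-- fixed unit tangent t_k = rot₉₀(d_k) at that point (true = +t_k, false = -t_k).
-- Counterclockwise motion on a circle centred at an A-vertex passes the point on
-- edge k in direction +t_k; on a circle centred at a B-vertex (where the point is
-- in direction -d_k from the centre) it passes in direction -t_k.
-- This sign is the same at both endpoints of a traversed link.
motion : Step → Bool
motion (((A , _) , _) , ccw) = ccw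
motion (((B , _) , _) , ccw) = not ccw

nextIdx : ∀ {m} → Fin (suc m) → Fin (suc m)
nextIdx {m} i = suc (toℕ i) mod suc m

-- A hexagonal Tangle of length n = suc m, given as a cyclic traversal
-- s₀, s₁, …, s_m of its n links:
--  * consecutive traversed links meet: the exit point of sᵢ is the entry point
--    of s_{i+1} (indices mod n), so the union is a closed curve;
--  * smooth: the direction of motion is continuous at every junction;
--  * simple: the links are pairwise distinct and the junction (tangency) points
--    are pairwise distinct.
record IsTangle (m : ℕ) (s : Fin (suc m) → Step) : Set where
  field
    closed : ∀ i → exit (s i) ≡ entry (s (nextIdx i))
    smooth : ∀ i → motion (s i) ≡ motion (s (nextIdx i))
    linksDistinct : ∀ i j → link (s i) ≡ link (s j) → i ≡ j
    pointsDistinct : ∀ i j → entry (s i) ≡ entry (s j) → i ≡ j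

-- In suitable lattice coordinates the junction points of a Tangle, read in order (and
-- reflected through the origin if the Tangle runs against the reference tangents t_k),
-- form a closed walk in ℤ² whose steps are E = (1 , 0), N = (0 , 1) and SW = (-1 , -1),
-- the three chord directions; the walk is simple since the junction points are distinct.
-- The form x + y rises by 1 along E and N and drops by 2 along SW, so the length is a
-- multiple of 3.
--
-- At a junction the walk changes direction exactly when the Tangle stays on the same
-- circle; otherwise it passes to a circle centred at a vertex of the other class of the
-- bipartite tiling.  So the length has the parity of the number of changes of direction,
-- which is odd by the rotation index theorem mod 2.  That is proved by Hopf's argument:
-- starting at the lowest point of the walk, the secants q j - q i (i < j) fill a grid
-- triangle, and we count crossings of the positive x-axis around its boundary.  The unit
-- squares contribute nothing, the bottom row stays in the upper half-plane and the right
-- column in the lower one, so the crossings along the diagonal, where the secant is the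
-- tangent, are odd because of the half turn around the missing corner where the secant
-- vanishes.  Finally, an odd multiple of 3 is 3 mod 6.

{-# OPTIONS --safe #-}
module Submission where

open import Defs
open import Data.Nat using (ℕ; suc; _%_)
open import Data.Fin using (Fin)
open import Relation.Binary.PropositionalEquality using (_≡_)

open import Data.Bool using (Bool; true; false; not; _∧_; _∨_; _xor_)
open import Data.Bool.Properties
  using ( xor-assoc; xor-same; xor-identityʳ; xor-inverseˡ; xor-annihilates-not
        ; not-involutive; ∧-conicalˡ; ∧-conicalʳ )
open import Data.Bool.Solver using (module xor-∧-Solver)
open import Data.Empty using (⊥-elim)
open import Data.Fin using (zero; suc; toℕ)
open import Data.Fin.Properties using (toℕ-fromℕ<; toℕ-injective; toℕ<n)
open import Data.Integer as ℤ using (ℤ; +_; -[1+_])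
import Data.Integer.Properties as ℤₚ
open import Algebra.Properties.AbelianGroup ℤₚ.+-0-abelianGroup using (∙-cancelˡ)
open import Data.Integer.Tactic.RingSolver using (solve-∀)
open import Data.Nat
  using (zero; pred; _+_; _*_; _∸_; _≤_; _<_; _/_; NonZero; >-nonZero; z≤n; s≤s; z<s; s<s)
open import Data.Nat.Properties
  using ( +-identityʳ; +-suc; +-assoc; +-comm; *-distribʳ-+; +-cancelˡ-≡; +-cancelˡ-<
        ; ≤-refl; <⇒≤; <⇒≱; <-trans; ≤-<-trans; n<1+n; m≤m+n; m<m+n; m<n+m
        ; m+[n∸m]≡n; m<n⇒0<n∸m )
open import Data.Nat.DivMod
  using (m≡m%n+[m/n]*n; m%n%n≡m%n; %-distribˡ-+; [m+n]%n≡m%n; m<n⇒m%n≡m; %-remove-+ˡ)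
open import Data.Nat.Divisibility using (_∣_; divides; ∣m+n∣m⇒∣n; ∣⇒≤; ∣-refl; n∣m*n)
open import Data.Product using (_×_; _,_; proj₁; proj₂; Σ)
open import Data.Product.Properties using (≡-dec)
open import Data.Sum using (_⊎_; inj₁; inj₂)
open import Relation.Nullary using (yes; no)
open import Relation.Binary.PropositionalEquality
  using (_≢_; refl; sym; trans; cong; cong₂; subst; module ≡-Reasoning)
open ≡-Reasoning
open xor-∧-Solver using (solve; _:+_; _:=_)

xor-cancel-middle : ∀ x y z → (x xor y) xor (y xor z) ≡ x xor z
xor-cancel-middle = solve 3 (λ x y z → (x :+ y) :+ (y :+ z) := x :+ z) refl

xor-interchange : ∀ w x y z → (w xor x) xor (y xor z) ≡ (w xor y) xor (x xor z)
xor-interchange = solve 4 (λ w x y z → (w :+ x) :+ (y :+ z) := (w :+ y) :+ (x :+ z)) refl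

xor-transpose : ∀ a b c d → a xor b ≡ c xor d → b xor d ≡ a xor c
xor-transpose a b c d eq = begin
  b xor d                  ≡⟨ solve 3 (λ a b d → b :+ d := (a :+ b) :+ (a :+ d)) refl a b d ⟩
  (a xor b) xor (a xor d)  ≡⟨ cong (_xor (a xor d)) eq ⟩
  (c xor d) xor (a xor d)  ≡⟨ solve 3 (λ a c d → (c :+ d) :+ (a :+ d) := a :+ c) refl a c d ⟩
  a xor c                  ∎

odd : ℕ → Bool
odd zero    = false
odd (suc n) = not (odd n)

⨁ : ℕ → ℕ → (ℕ → Bool) → Bool
⨁ a zero    f = false
⨁ a (suc l) f = f a xor ⨁ (suc a) l f

⨁-true : ∀ a l → ⨁ a l (λ _ → true) ≡ odd l
⨁-true a zero    = refl
⨁-true a (suc l) = cong not (⨁-true (suc a) l)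

⨁-snoc : ∀ a l f → ⨁ a (suc l) f ≡ ⨁ a l f xor f (a + l)
⨁-snoc a zero    f = trans (xor-identityʳ (f a)) (cong f (sym (+-identityʳ a)))
⨁-snoc a (suc l) f = begin
  f a xor ⨁ (suc a) (suc l) f                ≡⟨ cong (f a xor_) (⨁-snoc (suc a) l f) ⟩
  f a xor (⨁ (suc a) l f xor f (suc a + l))  ≡⟨ xor-assoc (f a) _ _ ⟨
  ⨁ a (suc l) f xor f (suc (a + l))          ≡⟨ cong (λ k → ⨁ a (suc l) f xor f k) (+-suc a l) ⟨
  ⨁ a (suc l) f xor f (a + suc l)            ∎

⨁-cong : ∀ a l {f g : ℕ → Bool} → (∀ j → f j ≡ g j) → ⨁ a l f ≡ ⨁ a l g
⨁-cong a zero    f≗g = refl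
⨁-cong a (suc l) f≗g = cong₂ _xor_ (f≗g a) (⨁-cong (suc a) l f≗g)

⨁-xor : ∀ a l (f g : ℕ → Bool) → ⨁ a l (λ j → f j xor g j) ≡ ⨁ a l f xor ⨁ a l g
⨁-xor a zero    f g = refl
⨁-xor a (suc l) f g =
  trans (cong ((f a xor g a) xor_) (⨁-xor (suc a) l f g)) (xor-interchange (f a) (g a) _ _)

⨁-telescope : ∀ a l (g : ℕ → Bool) → ⨁ a l (λ j → g j xor g (suc j)) ≡ g a xor g (a + l)
⨁-telescope a zero    g = sym (trans (cong (λ k → g a xor g k) (+-identityʳ a)) (xor-same (g a)))
⨁-telescope a (suc l) g = begin
  (g a xor g (suc a)) xor ⨁ (suc a) l (λ j → g j xor g (suc j))
    ≡⟨ cong ((g a xor g (suc a)) xor_) (⨁-telescope (suc a) l g) ⟩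
  (g a xor g (suc a)) xor (g (suc a) xor g (suc a + l))
    ≡⟨ xor-cancel-middle (g a) (g (suc a)) _ ⟩
  g a xor g (suc (a + l))
    ≡⟨ cong (λ k → g a xor g k) (+-suc a l) ⟨
  g a xor g (a + suc l)
    ∎

⨁-coboundary : ∀ l (f g : ℕ → Bool) → g l ≡ g 0 →
               ⨁ 0 l (λ j → f j xor (g j xor g (suc j))) ≡ ⨁ 0 l f
⨁-coboundary l f g periodic = begin
  ⨁ 0 l (λ j → f j xor (g j xor g (suc j)))    ≡⟨ ⨁-xor 0 l f _ ⟩
  ⨁ 0 l f xor ⨁ 0 l (λ j → g j xor g (suc j))  ≡⟨ cong (⨁ 0 l f xor_) (⨁-telescope 0 l g) ⟩
  ⨁ 0 l f xor (g 0 xor g l)                     ≡⟨ cong (λ b → ⨁ 0 l f xor (g 0 xor b)) periodic ⟩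
  ⨁ 0 l f xor (g 0 xor g 0)                     ≡⟨ cong (⨁ 0 l f xor_) (xor-same (g 0)) ⟩
  ⨁ 0 l f xor false                             ≡⟨ xor-identityʳ _ ⟩
  ⨁ 0 l f                                       ∎

shift-range : ∀ {a l j} → suc a ≤ j → j < suc a + l → a ≤ j × j < a + suc l
shift-range {a} {l} {j} a<j j<1+a+l = <⇒≤ a<j , subst (j <_) (sym (+-suc a l)) j<1+a+l

⨁-false : ∀ a l {f : ℕ → Bool} → (∀ j → a ≤ j → j < a + l → f j ≡ false) → ⨁ a l f ≡ false
⨁-false a zero    _        = refl
⨁-false a (suc l) f≡false =
  cong₂ _xor_ (f≡false a ≤-refl (m<m+n a z<s))
              (⨁-false (suc a) l λ j a<j j<1+a+l →
                let a≤j , j<a+1+l = shift-range a<j j<1+a+l in f≡false j a≤j j<a+1+l)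

⨁-ladder : ∀ a l (h h′ v : ℕ → Bool) →
           (∀ j → a ≤ j → j < a + l → h j xor v (suc j) ≡ v j xor h′ j) →
           ⨁ a l h xor v (a + l) ≡ v a xor ⨁ a l h′
⨁-ladder a zero    h h′ v _      = trans (cong v (+-identityʳ a)) (sym (xor-identityʳ (v a)))
⨁-ladder a (suc l) h h′ v square = begin
  (h a xor ⨁ (suc a) l h) xor v (a + suc l)  ≡⟨ cong (λ k → (h a xor ⨁ (suc a) l h) xor v k) (+-suc a l) ⟩
  (h a xor ⨁ (suc a) l h) xor v (suc a + l)  ≡⟨ xor-assoc (h a) _ _ ⟩
  h a xor (⨁ (suc a) l h xor v (suc a + l))  ≡⟨ cong (h a xor_) (⨁-ladder (suc a) l h h′ v inner) ⟩
  h a xor (v (suc a) xor ⨁ (suc a) l h′)     ≡⟨ xor-assoc (h a) _ _ ⟨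
  (h a xor v (suc a)) xor ⨁ (suc a) l h′     ≡⟨ cong (_xor ⨁ (suc a) l h′) (square a ≤-refl (m<m+n a z<s)) ⟩
  (v a xor h′ a) xor ⨁ (suc a) l h′          ≡⟨ xor-assoc (v a) _ _ ⟩
  v a xor (h′ a xor ⨁ (suc a) l h′)          ∎
  where
  inner : ∀ j → suc a ≤ j → j < suc a + l → h j xor v (suc j) ≡ v j xor h′ j
  inner j a<j j<1+a+l = let a≤j , j<a+1+l = shift-range a<j j<1+a+l in square j a≤j j<a+1+l

ℤ² : Set
ℤ² = ℤ × ℤ

0² : ℤ²
0² = (+ 0 , + 0)

infixl 6 _+²_ _-²_
infix  8 -²_

_+²_ : ℤ² → ℤ² → ℤ²
(a , b) +² (c , d) = (a ℤ.+ c , b ℤ.+ d)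

-²_ : ℤ² → ℤ²
-² (a , b) = (ℤ.- a , ℤ.- b)

_-²_ : ℤ² → ℤ² → ℤ²
u -² w = u +² -² w

+²-assoc : ∀ u v w → (u +² v) +² w ≡ u +² (v +² w)
+²-assoc (a , b) (c , d) (e , f) = cong₂ _,_ (ℤₚ.+-assoc a c e) (ℤₚ.+-assoc b d f)

-²-distrib-+² : ∀ u w → -² (u +² w) ≡ -² u +² -² w
-²-distrib-+² (a , b) (c , d) = cong₂ _,_ (ℤₚ.neg-distrib-+ a c) (ℤₚ.neg-distrib-+ b d)

-²-involutive : ∀ u → -² -² u ≡ u
-²-involutive (a , b) = cong₂ _,_ (ℤₚ.neg-involutive a) (ℤₚ.neg-involutive b)

u-w≡0⇒u≡w : ∀ u w → u -² w ≡ 0² → u ≡ w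
u-w≡0⇒u≡w (a , b) (c , d) eq =
  cong₂ _,_ (ℤₚ.i-j≡0⇒i≡j a c (cong proj₁ eq)) (ℤₚ.i-j≡0⇒i≡j b d (cong proj₂ eq))

[u+d]-u≡d : ∀ u d → (u +² d) -² u ≡ d
[u+d]-u≡d (a , b) (c , d) = cong₂ _,_ (lemma a c) (lemma b d)
  where lemma : ∀ x y → (x ℤ.+ y) ℤ.+ ℤ.- x ≡ y
        lemma = solve-∀

[u+d]-d≡u : ∀ u d → (u +² d) -² d ≡ u
[u+d]-d≡u (a , b) (c , d) = cong₂ _,_ (lemma a c) (lemma b d)
  where lemma : ∀ x y → (x ℤ.+ y) ℤ.+ ℤ.- y ≡ x
        lemma = solve-∀

u-[u+d]≡-d : ∀ u d → u -² (u +² d) ≡ -² d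
u-[u+d]≡-d (a , b) (c , d) = cong₂ _,_ (lemma a c) (lemma b d)
  where lemma : ∀ x y → x ℤ.+ ℤ.- (x ℤ.+ y) ≡ ℤ.- y
        lemma = solve-∀

[u+d]-w≡[u-w]+d : ∀ u d w → (u +² d) -² w ≡ (u -² w) +² d
[u+d]-w≡[u-w]+d (a , b) (c , d) (e , f) = cong₂ _,_ (lemma a c e) (lemma b d f)
  where lemma : ∀ x y z → (x ℤ.+ y) ℤ.+ ℤ.- z ≡ (x ℤ.+ ℤ.- z) ℤ.+ y
        lemma = solve-∀

u-[w+d]≡[u-w]-d : ∀ u w d → u -² (w +² d) ≡ (u -² w) -² d
u-[w+d]≡[u-w]-d (a , b) (c , d) (e , f) = cong₂ _,_ (lemma a c e) (lemma b d f)
  where lemma : ∀ x y z → x ℤ.+ ℤ.- (y ℤ.+ z) ≡ (x ℤ.+ ℤ.- y) ℤ.+ ℤ.- z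
        lemma = solve-∀

-[u-w]≡w-u : ∀ u w → -² (u -² w) ≡ w -² u
-[u-w]≡w-u (a , b) (c , d) = cong₂ _,_ (lemma a c) (lemma b d)
  where lemma : ∀ x y → ℤ.- (x ℤ.+ ℤ.- y) ≡ y ℤ.+ ℤ.- x
        lemma = solve-∀

u-w≡[u-v]+[v-w] : ∀ u v w → u -² w ≡ (u -² v) +² (v -² w)
u-w≡[u-v]+[v-w] (a , b) (c , d) (e , f) = cong₂ _,_ (lemma a c e) (lemma b d f)
  where lemma : ∀ x y z → x ℤ.+ ℤ.- z ≡ (x ℤ.+ ℤ.- y) ℤ.+ (y ℤ.+ ℤ.- z)
        lemma = solve-∀

orient : Bool → ℤ² → ℤ²
orient true  u = u
orient false u = -² u

orient-not : ∀ b u → orient (not b) u ≡ -² orient b u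
orient-not true  u = refl
orient-not false u = sym (-²-involutive u)

orient-+² : ∀ b u w → orient b (u +² w) ≡ orient b u +² orient b w
orient-+² true  u w = refl
orient-+² false u w = -²-distrib-+² u w

orient-shift : ∀ b u d → orient b (u +² orient b d) ≡ orient b u +² d
orient-shift true  u d = refl
orient-shift false u d = trans (-²-distrib-+² u (-² d)) (cong (-² u +²_) (-²-involutive d))

orient-injective : ∀ b {u w} → orient b u ≡ orient b w → u ≡ w
orient-injective true  eq = eq
orient-injective false {u} {w} eq =
  trans (sym (-²-involutive u)) (trans (cong -²_ eq) (-²-involutive w))

data Dir : Set where
  E N SW : Dir

vec : Dir → ℤ²
vec E  = (+ 1 , + 0)
vec N  = (+ 0 , + 1)
vec SW = (-[1+ 0 ] , -[1+ 0 ])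

turns : Dir → Dir → Bool
turns E  E  = false
turns N  N  = false
turns SW SW = false
turns _  _  = true

turns-refl : ∀ d → turns d d ≡ false
turns-refl E  = refl
turns-refl N  = refl
turns-refl SW = refl

isNorth : Dir → Bool
isNorth N = true
isNorth _ = false

-- Crossings of the positive x-axis

isPositive : ℤ → Bool
isPositive (+ suc _) = true
isPositive _         = false

upper : ℤ² → Bool
upper (x , + suc _)  = true
upper (x , + zero)   = isPositive x
upper (x , -[1+ _ ]) = false

upper-neg : ∀ u → u ≢ 0² → upper (-² u) ≡ not (upper u)
upper-neg (_ , + suc _)       _   = refl
upper-neg (_ , -[1+ _ ])      _   = refl
upper-neg (+ suc _ , + zero)  _   = refl
upper-neg (-[1+ _ ] , + zero) _   = refl
upper-neg (+ zero , + zero)   u≢0 = ⊥-elim (u≢0 refl)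

upper-+² : ∀ u w → upper u ≡ true → upper w ≡ true → upper (u +² w) ≡ true
upper-+² (_ , + suc _)       (_ , + suc _)       _ _ = refl
upper-+² (_ , + suc _)       (_ , + zero)        _ _ = refl
upper-+² (_ , + zero)        (_ , + suc _)       _ _ = refl
upper-+² (+ suc _ , + zero)  (+ suc _ , + zero)  _ _ = refl
upper-+² (+ suc _ , + zero)  (+ zero , + zero)   _ ()
upper-+² (+ suc _ , + zero)  (-[1+ _ ] , + zero) _ ()
upper-+² (+ zero , + zero)   _                   () _
upper-+² (-[1+ _ ] , + zero) _                   () _
upper-+² (_ , -[1+ _ ])      _                   () _
upper-+² (_ , + _)           (_ , -[1+ _ ])      _ ()

-- A unit step between nonzero vectors that changes `upper` crosses the x-axis, on its
-- positive half iff the x-coordinates have positive sum.  So along a closed path of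
-- unit steps avoiding 0, the xor of `crosses` is the winding number around 0 mod 2.
crosses : ℤ² → ℤ² → Bool
crosses u w = (upper u xor upper w) ∧ isPositive (proj₁ u ℤ.+ proj₁ w)

crosses-sameSide : ∀ u w → upper u ≡ upper w → crosses u w ≡ false
crosses-sameSide u w same =
  cong (_∧ isPositive (proj₁ u ℤ.+ proj₁ w)) (trans (cong (_xor upper w) same) (xor-same (upper w)))

crosses₂ : ℤ² → ℤ² → ℤ² → Bool
crosses₂ u v w = crosses u v xor crosses v w

tangentCrossing : Dir → Dir → Bool
tangentCrossing a b = crosses₂ (vec a) (vec a +² vec b) (vec b)

turns≡tangentCrossing : ∀ a b → turns a b ≡ tangentCrossing a b xor (isNorth a xor isNorth b)
turns≡tangentCrossing E  E  = refl
turns≡tangentCrossing E  N  = refl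
turns≡tangentCrossing E  SW = refl
turns≡tangentCrossing N  E  = refl
turns≡tangentCrossing N  N  = refl
turns≡tangentCrossing N  SW = refl
turns≡tangentCrossing SW E  = refl
turns≡tangentCrossing SW N  = refl
turns≡tangentCrossing SW SW = refl

-- The path -a, -a - b, -b is the antipode of the path a, a + b, b: together they go
-- once around 0.
corner-crossings : ∀ a b → upper (-² vec a) ≡ true → upper (vec b) ≡ true →
                   crosses₂ (-² vec a) (-² vec a -² vec b) (-² vec b) ≡ not (tangentCrossing a b)
corner-crossings SW E  _ _ = refl
corner-crossings SW N  _ _ = refl
corner-crossings SW SW _ ()
corner-crossings E  _  () _
corner-crossings N  _  () _

isZero : ℤ → Bool
isZero (+ zero) = true
isZero _        = false

isOrigin : ℤ² → Bool
isOrigin (x , y) = isZero y ∧ isZero x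

isOrigin-false : ∀ {u} → u ≢ 0² → isOrigin u ≡ false
isOrigin-false { + zero , + zero }   u≢0 = ⊥-elim (u≢0 refl)
isOrigin-false { + suc _ , + zero }  _   = refl
isOrigin-false { -[1+ _ ] , + zero } _   = refl
isOrigin-false { _ , + suc _ }       _   = refl
isOrigin-false { _ , -[1+ _ ] }      _   = refl

squareOK : Dir → Dir → ℤ² → Bool
squareOK s t u =
  isOrigin u ∨ isOrigin (u +² vec s) ∨ isOrigin (u -² vec t) ∨ isOrigin (u +² vec s -² vec t) ∨
  not (crosses₂ u (u +² vec s) (u +² vec s -² vec t) xor crosses₂ u (u -² vec t) (u +² vec s -² vec t))

∀Dir : (Dir → Bool) → Bool
∀Dir p = p E ∧ p N ∧ p SW

∀Dir-sound : ∀ {p} → ∀Dir p ≡ true → ∀ d → p d ≡ true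
∀Dir-sound {p} all E  = ∧-conicalˡ (p E) _ all
∀Dir-sound {p} all N  = ∧-conicalˡ (p N) _ (∧-conicalʳ (p E) _ all)
∀Dir-sound {p} all SW = ∧-conicalʳ (p N) _ (∧-conicalʳ (p E) _ all)

-- Besides the 5 × 5 window of base points there are tails in which all corners lie
-- strictly above or below the x-axis, or strictly left or right of the y-axis; there
-- the check still evaluates to true with the tail variable left open.
squares-ok : ∀ x y → ∀Dir (λ s → ∀Dir (λ t → squareOK s t (x , y))) ≡ true
squares-ok x -[1+ suc (suc n) ]           = refl
squares-ok x (+ suc (suc (suc n)))        = refl
squares-ok -[1+ suc (suc m) ] -[1+ 1 ]    = refl
squares-ok -[1+ 1 ] -[1+ 1 ]              = refl
squares-ok -[1+ 0 ] -[1+ 1 ]              = refl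
squares-ok (+ 0) -[1+ 1 ]                 = refl
squares-ok (+ 1) -[1+ 1 ]                 = refl
squares-ok (+ 2) -[1+ 1 ]                 = refl
squares-ok (+ suc (suc (suc m))) -[1+ 1 ] = refl
squares-ok -[1+ suc (suc m) ] -[1+ 0 ]    = refl
squares-ok -[1+ 1 ] -[1+ 0 ]              = refl
squares-ok -[1+ 0 ] -[1+ 0 ]              = refl
squares-ok (+ 0) -[1+ 0 ]                 = refl
squares-ok (+ 1) -[1+ 0 ]                 = refl
squares-ok (+ 2) -[1+ 0 ]                 = refl
squares-ok (+ suc (suc (suc m))) -[1+ 0 ] = refl
squares-ok -[1+ suc (suc m) ] (+ 0)       = refl
squares-ok -[1+ 1 ] (+ 0)                 = refl
squares-ok -[1+ 0 ] (+ 0)                 = refl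
squares-ok (+ 0) (+ 0)                    = refl
squares-ok (+ 1) (+ 0)                    = refl
squares-ok (+ 2) (+ 0)                    = refl
squares-ok (+ suc (suc (suc m))) (+ 0)    = refl
squares-ok -[1+ suc (suc m) ] (+ 1)       = refl
squares-ok -[1+ 1 ] (+ 1)                 = refl
squares-ok -[1+ 0 ] (+ 1)                 = refl
squares-ok (+ 0) (+ 1)                    = refl
squares-ok (+ 1) (+ 1)                    = refl
squares-ok (+ 2) (+ 1)                    = refl
squares-ok (+ suc (suc (suc m))) (+ 1)    = refl
squares-ok -[1+ suc (suc m) ] (+ 2)       = refl
squares-ok -[1+ 1 ] (+ 2)                 = refl
squares-ok -[1+ 0 ] (+ 2)                 = refl
squares-ok (+ 0) (+ 2)                    = refl
squares-ok (+ 1) (+ 2)                    = refl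
squares-ok (+ 2) (+ 2)                    = refl
squares-ok (+ suc (suc (suc m))) (+ 2)    = refl

squareOK-holds : ∀ s t u → squareOK s t u ≡ true
squareOK-holds s t u =
  ∀Dir-sound {λ t → squareOK s t u}
    (∀Dir-sound {λ s → ∀Dir (λ t → squareOK s t u)} (squares-ok (proj₁ u) (proj₂ u)) s) t

∨-falseˡ : ∀ {a b} → a ≡ false → a ∨ b ≡ true → b ≡ true
∨-falseˡ refl b≡true = b≡true

not-xor≡true⇒≡ : ∀ {a b} → not (a xor b) ≡ true → a ≡ b
not-xor≡true⇒≡ {true}  {true}  _ = refl
not-xor≡true⇒≡ {false} {false} _ = refl

square-crossings : ∀ s t {u us ut ust} → us ≡ u +² vec s → ut ≡ u -² vec t → ust ≡ us -² vec t →
                   u ≢ 0² → us ≢ 0² → ut ≢ 0² → ust ≢ 0² →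
                   crosses₂ u us ust ≡ crosses₂ u ut ust
square-crossings s t {u} refl refl refl u≢0 us≢0 ut≢0 ust≢0 =
  not-xor≡true⇒≡ (∨-falseˡ (isOrigin-false ust≢0) (∨-falseˡ (isOrigin-false ut≢0)
    (∨-falseˡ (isOrigin-false us≢0) (∨-falseˡ (isOrigin-false u≢0) (squareOK-holds s t u)))))

-- Hopf's argument for simple closed walks

module SimpleClosedWalk
  (n : ℕ) (q : ℕ → ℤ²) (c : ℕ → Dir)
  (step     : ∀ k → q (suc k) ≡ q k +² vec (c k))
  (closed   : q (3 + n) ≡ q 0)
  (c-closed : c (3 + n) ≡ c 0)
  (simple   : ∀ i j → i < j → j < i + (3 + n) → q i ≢ q j)
  (lowest   : ∀ j → 0 < j → j < 3 + n → upper (q j -² q 0) ≡ true)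
  where

  secant : ℕ → ℕ → ℤ²
  secant i j = q j -² q i

  secant-sucʳ : ∀ i j → secant i (suc j) ≡ secant i j +² vec (c j)
  secant-sucʳ i j = trans (cong (_-² q i) (step j)) ([u+d]-w≡[u-w]+d (q j) (vec (c j)) (q i))

  secant-sucˡ : ∀ i j → secant (suc i) j ≡ secant i j -² vec (c i)
  secant-sucˡ i j = trans (cong (λ p → q j -² p) (step i)) (u-[w+d]≡[u-w]-d (q j) (q i) (vec (c i)))

  secant-diagonal : ∀ i → secant i (suc i) ≡ vec (c i)
  secant-diagonal i = trans (cong (_-² q i) (step i)) ([u+d]-u≡d (q i) (vec (c i)))

  secant-≢0 : ∀ {i j} → i < j → j < i + (3 + n) → secant i j ≢ 0²
  secant-≢0 {i} {j} i<j j<i+L eq = simple i j i<j j<i+L (sym (u-w≡0⇒u≡w (q j) (q i) eq))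

  horizontal vertical : ℕ → ℕ → Bool
  horizontal i j = crosses (secant i j) (secant i (suc j))
  vertical   i j = crosses (secant i j) (secant (suc i) j)

  tangent : ℕ → Bool
  tangent k = tangentCrossing (c k) (c (suc k))

  square : ∀ {i j} → suc i < j → suc j < i + (3 + n) →
           horizontal i j xor vertical i (suc j) ≡ vertical i j xor horizontal (suc i) j
  square {i} {j} i+1<j j+1<i+L =
    square-crossings (c j) (c i) (secant-sucʳ i j) (secant-sucˡ i j) (secant-sucˡ i (suc j))
      (secant-≢0 i<j j<i+L) (secant-≢0 (<-trans i<j (n<1+n j)) j+1<i+L)
      (secant-≢0 i+1<j (<-trans j<i+L (n<1+n _))) (secant-≢0 (s<s i<j) (s<s j<i+L))
    where
    i<j : i < j
    i<j = <-trans (n<1+n i) i+1<j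
    j<i+L : j < i + (3 + n)
    j<i+L = <-trans (n<1+n j) j+1<i+L

  diagonal : ∀ i → horizontal i (suc i) xor vertical i (suc (suc i)) ≡ tangent i
  diagonal i =
    trans (cong₂ (λ u v → crosses₂ u v (secant (suc i) (suc (suc i)))) (secant-diagonal i) two-steps)
          (cong (crosses₂ (vec (c i)) (vec (c i) +² vec (c (suc i)))) (secant-diagonal (suc i)))
    where
    two-steps : secant i (suc (suc i)) ≡ vec (c i) +² vec (c (suc i))
    two-steps = trans (secant-sucʳ i (suc i)) (cong (_+² vec (c (suc i))) (secant-diagonal i))

  bottom-row : ∀ {j} → 0 < j → suc j < 3 + n → horizontal 0 j ≡ false
  bottom-row {j} 0<j j+1<L = crosses-sameSide (secant 0 j) (secant 0 (suc j))
    (trans (lowest j 0<j (<-trans (n<1+n j) j+1<L)) (sym (lowest (suc j) z<s j+1<L)))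

  below : ∀ {k} → 0 < k → k < 3 + n → upper (secant k (3 + n)) ≡ false
  below {k} 0<k k<L = begin
    upper (q (3 + n) -² q k)  ≡⟨ cong (λ p → upper (p -² q k)) closed ⟩
    upper (q 0 -² q k)        ≡⟨ cong upper (-[u-w]≡w-u (q k) (q 0)) ⟨
    upper (-² secant 0 k)     ≡⟨ upper-neg (secant 0 k) (secant-≢0 0<k k<L) ⟩
    not (upper (secant 0 k))  ≡⟨ cong not (lowest k 0<k k<L) ⟩
    false                     ∎

  right-column : ∀ {i} → 0 < i → suc i < 3 + n → vertical i (3 + n) ≡ false
  right-column {i} 0<i i+1<L = crosses-sameSide (secant i (3 + n)) (secant (suc i) (3 + n))
    (trans (below 0<i (<-trans (n<1+n i) i+1<L)) (sym (below z<s i+1<L)))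

  rows : ∀ l {i} → 0 < i → suc i + l ≡ 3 + n → ⨁ (suc i) l (horizontal i) ≡ ⨁ i l tangent
  rows zero    _   _         = refl
  rows (suc l) {i} 0<i i+l+2≡L = begin
    horizontal i (suc i) xor ⨁ (2 + i) l (horizontal i)
      ≡⟨ cong (horizontal i (suc i) xor_) ladder ⟩
    horizontal i (suc i) xor (vertical i (2 + i) xor ⨁ (2 + i) l (horizontal (suc i)))
      ≡⟨ xor-assoc (horizontal i (suc i)) _ _ ⟨
    (horizontal i (suc i) xor vertical i (2 + i)) xor ⨁ (2 + i) l (horizontal (suc i))
      ≡⟨ cong₂ _xor_ (diagonal i) (rows l z<s 2+i+l≡L) ⟩
    tangent i xor ⨁ (suc i) l tangent
      ∎
    where
    2+i+l≡L : 2 + i + l ≡ 3 + n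
    2+i+l≡L = trans (sym (+-suc (suc i) l)) i+l+2≡L
    squares : ∀ j → 2 + i ≤ j → j < 2 + i + l →
              horizontal i j xor vertical i (suc j) ≡ vertical i j xor horizontal (suc i) j
    squares j i+2≤j j<i+2+l =
      square i+2≤j (≤-<-trans (subst (suc j ≤_) 2+i+l≡L j<i+2+l) (m<n+m (3 + n) 0<i))
    right-end : vertical i (2 + i + l) ≡ false
    right-end = trans (cong (vertical i) 2+i+l≡L)
                      (right-column 0<i (subst (2 + i ≤_) 2+i+l≡L (m≤m+n (2 + i) l)))
    ladder : ⨁ (2 + i) l (horizontal i) ≡ vertical i (2 + i) xor ⨁ (2 + i) l (horizontal (suc i))
    ladder = begin
      ⨁ (2 + i) l (horizontal i)
        ≡⟨ xor-identityʳ _ ⟨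
      ⨁ (2 + i) l (horizontal i) xor false
        ≡⟨ cong (⨁ (2 + i) l (horizontal i) xor_) right-end ⟨
      ⨁ (2 + i) l (horizontal i) xor vertical i (2 + i + l)
        ≡⟨ ⨁-ladder (2 + i) l (horizontal i) (horizontal (suc i)) (vertical i) squares ⟩
      vertical i (2 + i) xor ⨁ (2 + i) l (horizontal (suc i))
        ∎

  corner : vertical 0 (2 + n) xor horizontal 1 (2 + n) ≡ not (tangent (2 + n))
  corner = begin
    crosses₂ (secant 0 (2 + n)) (secant 1 (2 + n)) (secant 1 (3 + n))
      ≡⟨ cong₂ (λ u v → crosses₂ u v (secant 1 (3 + n))) e₀ e₁ ⟩
    crosses₂ (-² a) (-² a -² b) (secant 1 (3 + n))
      ≡⟨ cong (crosses₂ (-² a) (-² a -² b)) e₂ ⟩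
    crosses₂ (-² a) (-² a -² b) (-² b)
      ≡⟨ corner-crossings (c (2 + n)) (c 0) upper-a upper-b ⟩
    not (tangentCrossing (c (2 + n)) (c 0))
      ≡⟨ cong (λ d → not (tangentCrossing (c (2 + n)) d)) c-closed ⟨
    not (tangent (2 + n))
      ∎
    where
    a b : ℤ²
    a = vec (c (2 + n))
    b = vec (c 0)
    e₀ : secant 0 (2 + n) ≡ -² a
    e₀ = trans (cong (λ p → q (2 + n) -² p) (trans (sym closed) (step (2 + n))))
               (u-[u+d]≡-d (q (2 + n)) a)
    e₁ : secant 1 (2 + n) ≡ -² a -² b
    e₁ = trans (secant-sucˡ 0 (2 + n)) (cong (_-² b) e₀)
    e₂ : secant 1 (3 + n) ≡ -² b
    e₂ = trans (cong₂ _-²_ closed (step 0)) (u-[u+d]≡-d (q 0) b)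
    upper-a : upper (-² a) ≡ true
    upper-a = subst (λ u → upper u ≡ true) e₀ (lowest (2 + n) z<s ≤-refl)
    upper-b : upper b ≡ true
    upper-b = subst (λ u → upper u ≡ true) (secant-diagonal 0) (lowest 1 z<s (s≤s (s≤s z≤n)))

  tangent-crossings-odd : ⨁ 0 (3 + n) tangent ≡ true
  tangent-crossings-odd = begin
    tangent 0 xor ⨁ 1 (2 + n) tangent
      ≡⟨ cong (tangent 0 xor_) (⨁-snoc 1 (suc n) tangent) ⟩
    tangent 0 xor (⨁ 1 (suc n) tangent xor τ)
      ≡⟨ cong₂ (λ t r → t xor (r xor τ)) (sym (diagonal 0)) (trans (sym row₁) (⨁-snoc 2 n (horizontal 1))) ⟩
    (α xor δ) xor ((ε xor ζ) xor τ)
      ≡⟨ solve 5 (λ a d e f x → (a :+ d) :+ ((e :+ f) :+ x) := (a :+ (d :+ e)) :+ (f :+ x)) refl α δ ε ζ τ ⟩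
    (α xor (δ xor ε)) xor (ζ xor τ)
      ≡⟨ cong (λ z → (α xor z) xor (ζ xor τ)) ladder₀ ⟨
    (α xor (β xor γ)) xor (ζ xor τ)
      ≡⟨ solve 5 (λ a b c f x → (a :+ (b :+ c)) :+ (f :+ x) := (a :+ b) :+ ((c :+ f) :+ x)) refl α β γ ζ τ ⟩
    (α xor β) xor ((γ xor ζ) xor τ)
      ≡⟨ cong₂ (λ z w → z xor (w xor τ)) row₀ corner ⟩
    not τ xor τ
      ≡⟨ xor-inverseˡ τ ⟩
    true
      ∎
    where
    α β γ δ ε ζ τ : Bool
    α = horizontal 0 1
    β = ⨁ 2 n (horizontal 0)
    γ = vertical 0 (2 + n)
    δ = vertical 0 2
    ε = ⨁ 2 n (horizontal 1)
    ζ = horizontal 1 (2 + n)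
    τ = tangent (2 + n)
    row₀ : α xor β ≡ false
    row₀ = ⨁-false 1 (suc n) (λ j 0<j j<2+n → bottom-row 0<j (s<s j<2+n))
    ladder₀ : β xor γ ≡ δ xor ε
    ladder₀ = ⨁-ladder 2 n (horizontal 0) (horizontal 1) (vertical 0)
                       (λ j 2≤j j<2+n → square 2≤j (s<s j<2+n))
    row₁ : ⨁ 2 (suc n) (horizontal 1) ≡ ⨁ 1 (suc n) tangent
    row₁ = rows (suc n) z<s refl

  turns-odd : ⨁ 0 (3 + n) (λ k → turns (c k) (c (suc k))) ≡ true
  turns-odd = begin
    ⨁ 0 (3 + n) (λ k → turns (c k) (c (suc k)))
      ≡⟨ ⨁-cong 0 (3 + n) (λ k → turns≡tangentCrossing (c k) (c (suc k))) ⟩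
    ⨁ 0 (3 + n) (λ k → tangent k xor (isNorth (c k) xor isNorth (c (suc k))))
      ≡⟨ ⨁-coboundary (3 + n) tangent (λ k → isNorth (c k)) (cong isNorth c-closed) ⟩
    ⨁ 0 (3 + n) tangent
      ≡⟨ tangent-crossings-odd ⟩
    true
      ∎

-- Length of closed walks

level : ℤ² → ℤ
level (x , y) = x ℤ.+ y

level-+² : ∀ u w → level (u +² w) ≡ level u ℤ.+ level w
level-+² (a , b) (c , d) = lemma a b c d
  where lemma : ∀ a b c d → (a ℤ.+ c) ℤ.+ (b ℤ.+ d) ≡ (a ℤ.+ b) ℤ.+ (c ℤ.+ d)
        lemma = solve-∀

southwest : Dir → ℕ
southwest SW = 1
southwest _  = 0

southwestSteps : (ℕ → Dir) → ℕ → ℕ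
southwestSteps c zero    = 0
southwestSteps c (suc k) = southwestSteps c k + southwest (c k)

level-vec : ∀ d → level (vec d) ℤ.+ + (southwest d * 3) ≡ + 1
level-vec E  = refl
level-vec N  = refl
level-vec SW = refl

module _ {q : ℕ → ℤ²} {c : ℕ → Dir} (step : ∀ k → q (suc k) ≡ q k +² vec (c k)) where

  level-walk : ∀ k → level (q k) ℤ.+ + (southwestSteps c k * 3) ≡ level (q 0) ℤ.+ + k
  level-walk zero    = refl
  level-walk (suc k) = begin
    level (q (suc k)) ℤ.+ + ((southwestSteps c k + southwest (c k)) * 3)
      ≡⟨ cong₂ ℤ._+_ (trans (cong level (step k)) (level-+² (q k) (vec (c k)))) SW-count ⟩
    (level (q k) ℤ.+ level (vec (c k))) ℤ.+ (+ (southwestSteps c k * 3) ℤ.+ + (southwest (c k) * 3))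
      ≡⟨ interchange (level (q k)) _ _ _ ⟩
    (level (q k) ℤ.+ + (southwestSteps c k * 3)) ℤ.+ (level (vec (c k)) ℤ.+ + (southwest (c k) * 3))
      ≡⟨ cong₂ ℤ._+_ (level-walk k) (level-vec (c k)) ⟩
    (level (q 0) ℤ.+ + k) ℤ.+ + 1
      ≡⟨ ℤₚ.+-assoc (level (q 0)) (+ k) (+ 1) ⟩
    level (q 0) ℤ.+ + (k + 1)
      ≡⟨ cong (λ i → level (q 0) ℤ.+ + i) (+-comm k 1) ⟩
    level (q 0) ℤ.+ + suc k
      ∎
    where
    interchange : ∀ a b c d → (a ℤ.+ b) ℤ.+ (c ℤ.+ d) ≡ (a ℤ.+ c) ℤ.+ (b ℤ.+ d)
    interchange = solve-∀
    SW-count : + ((southwestSteps c k + southwest (c k)) * 3)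
               ≡ + (southwestSteps c k * 3) ℤ.+ + (southwest (c k) * 3)
    SW-count = trans (cong +_ (*-distribʳ-+ 3 (southwestSteps c k) _))
                     (ℤₚ.pos-+ (southwestSteps c k * 3) (southwest (c k) * 3))

  closed-walk-length : ∀ L → q L ≡ q 0 → L ≡ southwestSteps c L * 3
  closed-walk-length L closed = sym (ℤₚ.+-injective (∙-cancelˡ (level (q 0)) _ _
    (trans (cong (λ p → level p ℤ.+ _) (sym closed)) (level-walk L))))

-- Tangency points of the hexagonal tiling

bit : Bool → ℤ
bit true  = + 1
bit false = + 0

offsetBits : Fin 3 → Bool × Bool
offsetBits zero             = (true , false)
offsetBits (suc zero)       = (true , true)
offsetBits (suc (suc zero)) = (false , false)

offset : Fin 3 → ℤ²
offset k = (bit (proj₁ (offsetBits k)) , bit (proj₂ (offsetBits k)))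

chord : Fin 3 → Dir
chord zero             = N
chord (suc zero)       = SW
chord (suc (suc zero)) = E

offset-next3 : ∀ k → offset (next3 k) ≡ offset k +² vec (chord k)
offset-next3 zero             = refl
offset-next3 (suc zero)       = refl
offset-next3 (suc (suc zero)) = refl

-- Coordinates with respect to the basis r (d₀ - d₂), r (d₁ - d₀), with origin the tangency
-- point on edge 2 of A(0,0).  E, N and SW are then the chords d₀ - d₂, d₁ - d₀, d₂ - d₁
-- joining the three tangency points around a vertex.
tangencyPoint : Edge → ℤ²
tangencyPoint (a , b , k) = (b ℤ.+ b , ℤ.- a ℤ.+ ℤ.- a) +² offset k

isA : Vertex → Bool
isA (A , _) = true
isA (B , _) = false

anchor : Vertex → ℤ²
anchor (A , a , b) = (b ℤ.+ b , ℤ.- a ℤ.+ ℤ.- a)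
anchor (B , a , b) = (b ℤ.+ b , ℤ.- a ℤ.+ ℤ.- a) +² (+ 2 , + 0)

tangencyPoint-edgeAt : ∀ v k → tangencyPoint (edgeAt v k) ≡ anchor v +² orient (isA v) (offset k)
tangencyPoint-edgeAt (A , a , b) k = refl
tangencyPoint-edgeAt (B , a , b) k = around-B k
  where
  even : ∀ z → (z ℤ.+ z) ℤ.+ + 1 ≡ ((z ℤ.+ z) ℤ.+ + 2) ℤ.+ -[1+ 0 ]
  even = solve-∀
  unchanged : ∀ z → z ℤ.+ + 0 ≡ (z ℤ.+ + 0) ℤ.+ + 0
  unchanged = solve-∀
  shifted : ∀ z → (ℤ.- (z ℤ.+ + 1) ℤ.+ ℤ.- (z ℤ.+ + 1)) ℤ.+ + 1 ≡ ((ℤ.- z ℤ.+ ℤ.- z) ℤ.+ + 0) ℤ.+ -[1+ 0 ]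
  shifted = solve-∀
  doubled : ∀ z → ((z ℤ.+ + 1) ℤ.+ (z ℤ.+ + 1)) ℤ.+ + 0 ≡ ((z ℤ.+ z) ℤ.+ + 2) ℤ.+ + 0
  doubled = solve-∀
  around-B : ∀ k → tangencyPoint (edgeAt (B , a , b) k) ≡ anchor (B , a , b) +² -² offset k
  around-B zero             = cong₂ _,_ (even b) (unchanged (ℤ.- a ℤ.+ ℤ.- a))
  around-B (suc zero)       = cong₂ _,_ (even b) (shifted a)
  around-B (suc (suc zero)) = cong₂ _,_ (doubled b) (unchanged (ℤ.- a ℤ.+ ℤ.- a))

tangencyPoint-next3 : ∀ v j → tangencyPoint (edgeAt v (next3 j))
                              ≡ tangencyPoint (edgeAt v j) +² orient (isA v) (vec (chord j))
tangencyPoint-next3 v j = begin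
  tangencyPoint (edgeAt v (next3 j))
    ≡⟨ tangencyPoint-edgeAt v (next3 j) ⟩
  anchor v +² orient σ (offset (next3 j))
    ≡⟨ cong (λ o → anchor v +² orient σ o) (offset-next3 j) ⟩
  anchor v +² orient σ (offset j +² vec (chord j))
    ≡⟨ cong (anchor v +²_) (orient-+² σ (offset j) _) ⟩
  anchor v +² (orient σ (offset j) +² orient σ (vec (chord j)))
    ≡⟨ +²-assoc (anchor v) _ _ ⟨
  (anchor v +² orient σ (offset j)) +² orient σ (vec (chord j))
    ≡⟨ cong (_+² orient σ (vec (chord j))) (tangencyPoint-edgeAt v j) ⟨
  tangencyPoint (edgeAt v j) +² orient σ (vec (chord j))
    ∎
  where
  σ : Bool
  σ = isA v

linkIndex : Step → Fin 3
linkIndex ((_ , j) , _) = j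

centre : Step → Vertex
centre ((v , _) , _) = v

counterclockwise : Step → Bool
counterclockwise (_ , ccw) = ccw

motion-formula : ∀ st → motion st ≡ not (counterclockwise st) xor isA (centre st)
motion-formula (((A , _) , _) , true)  = refl
motion-formula (((A , _) , _) , false) = refl
motion-formula (((B , _) , _) , true)  = refl
motion-formula (((B , _) , _) , false) = refl

tangencyPoint-exit : ∀ st → tangencyPoint (exit st)
                            ≡ tangencyPoint (entry st) +² orient (motion st) (vec (chord (linkIndex st)))
tangencyPoint-exit st@((v , j) , true) =
  trans (tangencyPoint-next3 v j)
        (cong (λ b → tangencyPoint (edgeAt v j) +² orient b (vec (chord j))) (sym (motion-formula st)))
tangencyPoint-exit st@((v , j) , false) = begin
  tangencyPoint (edgeAt v j)
    ≡⟨ [u+d]-d≡u (tangencyPoint (edgeAt v j)) d ⟨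
  (tangencyPoint (edgeAt v j) +² d) -² d
    ≡⟨ cong (_-² d) (tangencyPoint-next3 v j) ⟨
  tangencyPoint (edgeAt v (next3 j)) +² -² d
    ≡⟨ cong (tangencyPoint (edgeAt v (next3 j)) +²_) (orient-not (isA v) _) ⟨
  tangencyPoint (edgeAt v (next3 j)) +² orient (not (isA v)) (vec (chord j))
    ≡⟨ cong (λ b → tangencyPoint (edgeAt v (next3 j)) +² orient b (vec (chord j))) (sym (motion-formula st)) ⟩
  tangencyPoint (edgeAt v (next3 j)) +² orient (motion st) (vec (chord j))
    ∎
  where
  d : ℤ²
  d = orient (isA v) (vec (chord j))

double≢1 : ∀ z → z ℤ.+ z ≢ + 1
double≢1 (+ zero)  ()
double≢1 (+ suc n) eq with trans (sym (+-suc n n)) (cong pred (ℤₚ.+-injective eq))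
... | ()
double≢1 -[1+ n ]  ()

double≢-1 : ∀ z → z ℤ.+ z ≢ -[1+ 0 ]
double≢-1 (+ n)    ()
double≢-1 -[1+ n ] ()

double≡0 : ∀ z → z ℤ.+ z ≡ + 0 → z ≡ + 0
double≡0 (+ zero)  _  = refl
double≡0 (+ suc n) ()
double≡0 -[1+ n ]  ()

double-difference : ∀ z z′ p p′ → (z ℤ.+ z) ℤ.+ p ≡ (z′ ℤ.+ z′) ℤ.+ p′ →
                    (z ℤ.- z′) ℤ.+ (z ℤ.- z′) ≡ p′ ℤ.- p
double-difference z z′ p p′ eq = begin
  (z ℤ.- z′) ℤ.+ (z ℤ.- z′)
    ≡⟨ expand z z′ p p′ ⟩
  (((z ℤ.+ z) ℤ.+ p) ℤ.- ((z′ ℤ.+ z′) ℤ.+ p′)) ℤ.+ (p′ ℤ.- p)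
    ≡⟨ cong (λ w → (w ℤ.- ((z′ ℤ.+ z′) ℤ.+ p′)) ℤ.+ (p′ ℤ.- p)) eq ⟩
  (((z′ ℤ.+ z′) ℤ.+ p′) ℤ.- ((z′ ℤ.+ z′) ℤ.+ p′)) ℤ.+ (p′ ℤ.- p)
    ≡⟨ cancel ((z′ ℤ.+ z′) ℤ.+ p′) p p′ ⟩
  p′ ℤ.- p
    ∎
  where
  expand : ∀ z z′ p p′ → (z ℤ.- z′) ℤ.+ (z ℤ.- z′)
                         ≡ (((z ℤ.+ z) ℤ.+ p) ℤ.- ((z′ ℤ.+ z′) ℤ.+ p′)) ℤ.+ (p′ ℤ.- p)
  expand = solve-∀
  cancel : ∀ w p p′ → (w ℤ.- w) ℤ.+ (p′ ℤ.- p) ≡ p′ ℤ.- p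
  cancel = solve-∀

double+bit-injective : ∀ {z z′} o o′ → (z ℤ.+ z) ℤ.+ bit o ≡ (z′ ℤ.+ z′) ℤ.+ bit o′ → z ≡ z′ × o ≡ o′
double+bit-injective {z} {z′} true  true  eq =
  ℤₚ.i-j≡0⇒i≡j z z′ (double≡0 (z ℤ.- z′) (double-difference z z′ _ _ eq)) , refl
double+bit-injective {z} {z′} false false eq =
  ℤₚ.i-j≡0⇒i≡j z z′ (double≡0 (z ℤ.- z′) (double-difference z z′ _ _ eq)) , refl
double+bit-injective {z} {z′} true  false eq = ⊥-elim (double≢-1 (z ℤ.- z′) (double-difference z z′ _ _ eq))
double+bit-injective {z} {z′} false true  eq = ⊥-elim (double≢1 (z ℤ.- z′) (double-difference z z′ _ _ eq))

fromBits : Bool × Bool → Fin 3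
fromBits (true  , false) = zero
fromBits (true  , true)  = suc zero
fromBits (false , _)     = suc (suc zero)

fromBits-offsetBits : ∀ k → fromBits (offsetBits k) ≡ k
fromBits-offsetBits zero             = refl
fromBits-offsetBits (suc zero)       = refl
fromBits-offsetBits (suc (suc zero)) = refl

-- The parities of the coordinates give k, halving them gives a and b.
tangencyPoint-injective : ∀ e e′ → tangencyPoint e ≡ tangencyPoint e′ → e ≡ e′
tangencyPoint-injective (a , b , k) (a′ , b′ , k′) eq =
  cong₂ _,_ (ℤₚ.neg-injective (proj₁ y≡)) (cong₂ _,_ (proj₁ x≡) k≡k′)
  where
  x≡ : b ≡ b′ × proj₁ (offsetBits k) ≡ proj₁ (offsetBits k′)
  x≡ = double+bit-injective (proj₁ (offsetBits k)) (proj₁ (offsetBits k′)) (cong proj₁ eq)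
  y≡ : ℤ.- a ≡ ℤ.- a′ × proj₂ (offsetBits k) ≡ proj₂ (offsetBits k′)
  y≡ = double+bit-injective (proj₂ (offsetBits k)) (proj₂ (offsetBits k′)) (cong proj₂ eq)
  k≡k′ : k ≡ k′
  k≡k′ = trans (sym (fromBits-offsetBits k))
               (trans (cong fromBits (cong₂ _,_ (proj₂ x≡) (proj₂ y≡))) (fromBits-offsetBits k′))

exitIndex entryIndex : Bool → Fin 3 → Fin 3
exitIndex true  j = next3 j
exitIndex false j = j
entryIndex true  j = j
entryIndex false j = next3 j

direction : Edge → Fin 3
direction (_ , _ , k) = k

direction-edgeAt : ∀ v k → direction (edgeAt v k) ≡ k
direction-edgeAt (A , _) k                = refl
direction-edgeAt (B , _) zero             = refl
direction-edgeAt (B , _) (suc zero)       = refl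
direction-edgeAt (B , _) (suc (suc zero)) = refl

direction-exit : ∀ st → direction (exit st) ≡ exitIndex (counterclockwise st) (linkIndex st)
direction-exit ((v , j) , true)  = direction-edgeAt v (next3 j)
direction-exit ((v , j) , false) = direction-edgeAt v j

direction-entry : ∀ st → direction (entry st) ≡ entryIndex (counterclockwise st) (linkIndex st)
direction-entry ((v , j) , true)  = direction-edgeAt v j
direction-entry ((v , j) , false) = direction-edgeAt v (next3 j)

prev3 : Fin 3 → Fin 3
prev3 zero             = suc (suc zero)
prev3 (suc zero)       = zero
prev3 (suc (suc zero)) = suc zero

prev3-next3 : ∀ j → prev3 (next3 j) ≡ j
prev3-next3 zero             = refl
prev3-next3 (suc zero)       = refl
prev3-next3 (suc (suc zero)) = refl

next3-injective : ∀ {j j′} → next3 j ≡ next3 j′ → j ≡ j′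
next3-injective {j} {j′} e = trans (sym (prev3-next3 j)) (trans (cong prev3 e) (prev3-next3 j′))

turns-chord-next3 : ∀ j → turns (chord j) (chord (next3 j)) ≡ true
turns-chord-next3 zero             = refl
turns-chord-next3 (suc zero)       = refl
turns-chord-next3 (suc (suc zero)) = refl

turns-next3-chord : ∀ j → turns (chord (next3 j)) (chord j) ≡ true
turns-next3-chord zero             = refl
turns-next3-chord (suc zero)       = refl
turns-next3-chord (suc (suc zero)) = refl

junction-indices : ∀ ccw j ccw′ j′ → exitIndex ccw j ≡ entryIndex ccw′ j′ →
                   turns (chord j) (chord j′) ≡ not (ccw xor ccw′)
junction-indices true  j           true  .(next3 j) refl = turns-chord-next3 j
junction-indices false .(next3 j′) false j′         refl = turns-next3-chord j′
junction-indices false j           true  .j         refl = turns-refl (chord j)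
junction-indices true  j           false j′         e with next3-injective e
... | refl = turns-refl (chord j)

junction-turns : ∀ st st′ → exit st ≡ entry st′ → motion st ≡ motion st′ →
                 turns (chord (linkIndex st)) (chord (linkIndex st′))
                   ≡ not (isA (centre st) xor isA (centre st′))
junction-turns st st′ meet smooth = begin
  turns (chord (linkIndex st)) (chord (linkIndex st′))
    ≡⟨ junction-indices ccw (linkIndex st) ccw′ (linkIndex st′) indices ⟩
  not (ccw xor ccw′)
    ≡⟨ cong not sides ⟩
  not (isA (centre st) xor isA (centre st′))
    ∎
  where
  ccw ccw′ : Bool
  ccw  = counterclockwise st
  ccw′ = counterclockwise st′
  indices : exitIndex ccw (linkIndex st) ≡ entryIndex ccw′ (linkIndex st′)
  indices = trans (sym (direction-exit st)) (trans (cong direction meet) (direction-entry st′))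
  sides : ccw xor ccw′ ≡ isA (centre st) xor isA (centre st′)
  sides = sym (trans (xor-transpose (not ccw) (isA (centre st)) (not ccw′) (isA (centre st′))
                                    (trans (sym (motion-formula st)) (trans smooth (motion-formula st′))))
                     (xor-annihilates-not ccw ccw′))

-- Cyclic order and the lowest point

_≼_ : ℤ² → ℤ² → Set
u ≼ w = u ≡ w ⊎ upper (w -² u) ≡ true

≼-total : ∀ u w → u ≼ w ⊎ w ≼ u
≼-total u w with ≡-dec ℤ._≟_ ℤ._≟_ u w
... | yes u≡w = inj₁ (inj₁ u≡w)
... | no  u≢w with upper (w -² u) in up
...   | true  = inj₁ (inj₂ refl)
...   | false = inj₂ (inj₂ (begin
  upper (u -² w)        ≡⟨ cong upper (-[u-w]≡w-u w u) ⟨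
  upper (-² (w -² u))   ≡⟨ upper-neg (w -² u) (λ w-u≡0 → u≢w (sym (u-w≡0⇒u≡w w u w-u≡0))) ⟩
  not (upper (w -² u))  ≡⟨ cong not up ⟩
  true                  ∎))

≼-trans : ∀ {u v w} → u ≼ v → v ≼ w → u ≼ w
≼-trans (inj₁ refl) v≼w         = v≼w
≼-trans (inj₂ up)   (inj₁ refl) = inj₂ up
≼-trans {u} {v} {w} (inj₂ up₁) (inj₂ up₂) =
  inj₂ (subst (λ d → upper d ≡ true) (sym (u-w≡[u-v]+[v-w] w v u)) (upper-+² (w -² v) (v -² u) up₂ up₁))

argmin : ∀ {n} (f : Fin (suc n) → ℤ²) → Σ (Fin (suc n)) λ i → ∀ k → f i ≼ f k
argmin {zero}  f = zero , λ { zero → inj₁ refl }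
argmin {suc n} f with argmin (λ k → f (suc k))
... | i , least with ≼-total (f zero) (f (suc i))
...   | inj₁ f₀≼fᵢ = zero  , λ { zero → inj₁ refl ; (suc k) → ≼-trans f₀≼fᵢ (least k) }
...   | inj₂ fᵢ≼f₀ = suc i , λ { zero → fᵢ≼f₀    ; (suc k) → least k }

orbit : ∀ {m} → Fin (suc m) → ℕ → Fin (suc m)
orbit i zero    = i
orbit i (suc k) = nextIdx (orbit i k)

suc-%-% : ∀ x n .{{_ : NonZero n}} → suc (x % n) % n ≡ suc x % n
suc-%-% x n = begin
  (1 + x % n) % n          ≡⟨ %-distribˡ-+ 1 (x % n) n ⟩
  (1 % n + x % n % n) % n  ≡⟨ cong (λ r → (1 % n + r) % n) (m%n%n≡m%n x n) ⟩
  (1 % n + x % n) % n      ≡⟨ %-distribˡ-+ 1 x n ⟨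
  (1 + x) % n              ∎

toℕ-orbit : ∀ {m} (i : Fin (suc m)) k → toℕ (orbit i k) ≡ (toℕ i + k) % suc m
toℕ-orbit {m} i zero    = trans (sym (m<n⇒m%n≡m (toℕ<n i))) (cong (_% suc m) (sym (+-identityʳ (toℕ i))))
toℕ-orbit {m} i (suc k) = begin
  toℕ (nextIdx (orbit i k))          ≡⟨ toℕ-fromℕ< _ ⟩
  suc (toℕ (orbit i k)) % suc m      ≡⟨ cong (λ r → suc r % suc m) (toℕ-orbit i k) ⟩
  suc ((toℕ i + k) % suc m) % suc m  ≡⟨ suc-%-% (toℕ i + k) (suc m) ⟩
  suc (toℕ i + k) % suc m            ≡⟨ cong (_% suc m) (+-suc (toℕ i) k) ⟨
  (toℕ i + suc k) % suc m            ∎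

orbit-period : ∀ {m} (i : Fin (suc m)) → orbit i (suc m) ≡ i
orbit-period {m} i = toℕ-injective (begin
  toℕ (orbit i (suc m))    ≡⟨ toℕ-orbit i (suc m) ⟩
  (toℕ i + suc m) % suc m  ≡⟨ [m+n]%n≡m%n (toℕ i) (suc m) ⟩
  toℕ i % suc m            ≡⟨ m<n⇒m%n≡m (toℕ<n i) ⟩
  toℕ i                    ∎)

%-shift-≢ : ∀ x d n .{{_ : NonZero n}} → 0 < d → d < n → (x + d) % n ≢ x % n
%-shift-≢ x d n 0<d d<n eq = <⇒≱ d<n (∣⇒≤ {{>-nonZero 0<d}} n∣d)
  where
  quotients : (x / n) * n + d ≡ ((x + d) / n) * n
  quotients = +-cancelˡ-≡ (x % n) _ _ (begin
    x % n + ((x / n) * n + d)        ≡⟨ +-assoc (x % n) _ d ⟨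
    (x % n + (x / n) * n) + d        ≡⟨ cong (_+ d) (m≡m%n+[m/n]*n x n) ⟨
    x + d                            ≡⟨ m≡m%n+[m/n]*n (x + d) n ⟩
    (x + d) % n + ((x + d) / n) * n  ≡⟨ cong (_+ ((x + d) / n) * n) eq ⟩
    x % n + ((x + d) / n) * n        ∎)
  n∣d : n ∣ d
  n∣d = ∣m+n∣m⇒∣n (divides ((x + d) / n) quotients) (n∣m*n (x / n))

orbit-injective : ∀ {m} (a : Fin (suc m)) {i j} → i < j → j < i + suc m → orbit a i ≢ orbit a j
orbit-injective {m} a {i} {j} i<j j<i+L same =
  %-shift-≢ (toℕ a + i) (j ∸ i) (suc m) (m<n⇒0<n∸m i<j) d<L (begin
    (toℕ a + i + (j ∸ i)) % suc m
      ≡⟨ cong (_% suc m) (trans (+-assoc (toℕ a) i _) (cong (λ r → toℕ a + r) i+d≡j)) ⟩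
    (toℕ a + j) % suc m  ≡⟨ toℕ-orbit a j ⟨
    toℕ (orbit a j)      ≡⟨ cong toℕ same ⟨
    toℕ (orbit a i)      ≡⟨ toℕ-orbit a i ⟩
    (toℕ a + i) % suc m  ∎)
  where
  i+d≡j : i + (j ∸ i) ≡ j
  i+d≡j = m+[n∸m]≡n (<⇒≤ i<j)
  d<L : j ∸ i < suc m
  d<L = +-cancelˡ-< i (j ∸ i) (suc m) (subst (_< i + suc m) (sym i+d≡j) j<i+L)

-- Tangles as lattice walks

module Tangle {m : ℕ} {s : Fin (suc m) → Step} (tangle : IsTangle m s) where
  open IsTangle tangle

  point : Fin (suc m) → ℤ²
  point i = orient (motion (s i)) (tangencyPoint (entry (s i)))

  start : Fin (suc m)
  start = proj₁ (argmin point)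

  q : ℕ → ℤ²
  q k = point (orbit start k)

  c : ℕ → Dir
  c k = chord (linkIndex (s (orbit start k)))

  centredAtA : ℕ → Bool
  centredAtA k = isA (centre (s (orbit start k)))

  step : ∀ k → q (suc k) ≡ q k +² vec (c k)
  step k = begin
    orient (motion (s (nextIdx ι))) (tangencyPoint (entry (s (nextIdx ι))))
      ≡⟨ cong₂ (λ b e → orient b (tangencyPoint e)) (smooth ι) (closed ι) ⟨
    orient μ (tangencyPoint (exit (s ι)))
      ≡⟨ cong (orient μ) (tangencyPoint-exit (s ι)) ⟩
    orient μ (tangencyPoint (entry (s ι)) +² orient μ (vec (c k)))
      ≡⟨ orient-shift μ (tangencyPoint (entry (s ι))) (vec (c k)) ⟩
    q k +² vec (c k)
      ∎
    where
    ι : Fin (suc m)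
    ι = orbit start k
    μ : Bool
    μ = motion (s ι)

  junction : ∀ k → turns (c k) (c (suc k)) ≡ not (centredAtA k xor centredAtA (suc k))
  junction k = junction-turns (s ι) (s (nextIdx ι)) (closed ι) (smooth ι)
    where
    ι : Fin (suc m)
    ι = orbit start k

  motion-orbit : ∀ k → motion (s (orbit start k)) ≡ motion (s start)
  motion-orbit zero    = refl
  motion-orbit (suc k) = trans (sym (smooth (orbit start k))) (motion-orbit k)

  simple : ∀ i j → i < j → j < i + suc m → q i ≢ q j
  simple i j i<j j<i+L qᵢ≡qⱼ =
    orbit-injective start i<j j<i+L
      (pointsDistinct _ _ (tangencyPoint-injective _ _ (orient-injective (motion (s start)) same)))
    where
    X : ℕ → ℤ²
    X k = tangencyPoint (entry (s (orbit start k)))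
    same : orient (motion (s start)) (X i) ≡ orient (motion (s start)) (X j)
    same = trans (cong (λ b → orient b (X i)) (sym (motion-orbit i)))
                 (trans qᵢ≡qⱼ (cong (λ b → orient b (X j)) (motion-orbit j)))

  q-closed : q (suc m) ≡ q 0
  q-closed = cong point (orbit-period start)

  c-closed : c (suc m) ≡ c 0
  c-closed = cong (λ ι → chord (linkIndex (s ι))) (orbit-period start)

  centredAtA-closed : centredAtA (suc m) ≡ centredAtA 0
  centredAtA-closed = cong (λ ι → isA (centre (s ι))) (orbit-period start)

  lowest : ∀ j → 0 < j → j < suc m → upper (q j -² q 0) ≡ true
  lowest j 0<j j<L with proj₂ (argmin point) (orbit start j)
  ... | inj₁ q₀≡qⱼ = ⊥-elim (simple 0 j 0<j j<L q₀≡qⱼ)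
  ... | inj₂ above = above

  length≡southwestSteps*3 : suc m ≡ southwestSteps c (suc m) * 3
  length≡southwestSteps*3 = closed-walk-length {q} {c} step (suc m) q-closed

  odd-length≡turns : odd (suc m) ≡ ⨁ 0 (suc m) (λ k → turns (c k) (c (suc k)))
  odd-length≡turns = begin
    odd (suc m)
      ≡⟨ ⨁-true 0 (suc m) ⟨
    ⨁ 0 (suc m) (λ _ → true)
      ≡⟨ ⨁-coboundary (suc m) (λ _ → true) centredAtA centredAtA-closed ⟨
    ⨁ 0 (suc m) (λ k → true xor (centredAtA k xor centredAtA (suc k)))
      ≡⟨ ⨁-cong 0 (suc m) (λ k → sym (junction k)) ⟩
    ⨁ 0 (suc m) (λ k → turns (c k) (c (suc k)))
      ∎

length-odd : ∀ n {s : Fin (3 + n) → Step} → IsTangle (2 + n) s → odd (3 + n) ≡ true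
length-odd n tangle =
  trans odd-length≡turns (SimpleClosedWalk.turns-odd n q c step q-closed c-closed simple lowest)
  where open Tangle tangle

odd-*3 : ∀ x → odd (x * 3) ≡ odd x
odd-*3 zero    = refl
odd-*3 (suc x) = trans (not-involutive _) (cong not (odd-*3 x))

odd-*3-%6 : ∀ x → odd x ≡ true → x * 3 % 6 ≡ 3
odd-*3-%6 (suc zero)    _     = refl
odd-*3-%6 (suc (suc x)) odd-x =
  trans (%-remove-+ˡ (x * 3) ∣-refl) (odd-*3-%6 x (trans (sym (not-involutive (odd x))) odd-x))

length-mod-6 : ∀ m {s : Fin (suc m) → Step} → IsTangle m s → ∀ x → suc m ≡ x * 3 → suc m % 6 ≡ 3
length-mod-6 .(2 + x * 3) tangle (suc x) refl =
  odd-*3-%6 (suc x) (trans (sym (odd-*3 (suc x))) (length-odd (x * 3) tangle))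

corollary4p3 : (m : ℕ) (s : Fin (suc m) → Step) → IsTangle m s → suc m % 6 ≡ 3
corollary4p3 m s tangle = length-mod-6 m tangle (southwestSteps c (suc m)) length≡southwestSteps*3
  where open Tangle tangle
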